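{- For every integer $s\ge 2$ there exist $t\in[2s-1]\setminus\{s\}$ and, for each $j\in[s-1]$, integers $a_j,b_j\in[4s-1]\setminus\{2s\}$ such that, with $d=\min(2t,4s-2t)$, all of the following hold: (1) $a_j<b_j$ for each $j\in[s-1]$; (2) the $2s-1$ numbers $\min(a_j,4s-a_j)$ ($j\in[s-1]$), $\min(b_j,4s-b_j)$ ($j\in[s-1]$), and $t$ are pairwise distinct; (3) the $s+1$ numbers $\min(b_j-a_j,\,4s-b_j+a_j)$ ($j\in[s-1]$), $2s$, and $d$ are pairwise distinct; (4) the $s$ numbers $\min(a_j\oplus b_j,\,4s-(a_j\oplus b_j))$ ($j\in[s-1]$) and $2s$ are pairwise distinct, where $a\oplus b$ denotes the residue of $a+b$ modulo $4s$ in $\{0,1,\dots,4s-1\}$; (5) $4s/\gcd(d,4s)$ is even.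
   Context: $[n]$ denotes $\{1,\dots,n\}$. -}

module Defs where

open import Data.Nat using (ℕ; zero; suc; _+_; _*_; _∸_; _⊓_; _%_; _/_; _≡ᵇ_; NonZero; ≢-nonZero)
open import Data.Nat.GCD using (gcd; gcd[m,n]≢0)
open import Data.Sum using (inj₂)
open import Relation.Binary.PropositionalEquality using (_≢_)

-- 4s / gcd(d, 4s), for s ≥ 1 (for s = 0 we return 0; irrelevant since s ≥ 2).
ratio4s : ℕ → ℕ → ℕ
ratio4s zero    d = 0
ratio4s (suc k) d =
  _/_ (4 * suc k) (gcd d (4 * suc k))
      {{≢-nonZero (gcd[m,n]≢0 d (4 * suc k) (inj₂ (λ ())))}}

oplus : ℕ → ℕ → ℕ → ℕ
oplus zero    a b = 0
oplus (suc k) a b = (a + b) % (4 * suc k)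

-- Take t = 1, so that d = 2 and 4s / gcd(2, 4s) = 2s is even.  Write |z| = min(z, 4s − z).  If
-- 1 ≤ x < y = x + u < 2s, the pair (x, y) has |a| = x, |b| = y, |b − a| = u and |a ⊕ b| = |x + y|,
-- while the pair (x, 4s − y) has the same |a| and |b| with the difference and sum values interchanged.
-- Writing s = 3 + rA + rB + 6q, the s − 1 pairs come from two such families, indexed by
-- i + e = rA + 3q and by i + e = rB + 3q, in which x, u and |x + y| are affine in i and e, hence
-- affine in q and in one variable ranging over [0, r + 3q].  The required distinctness then reduces
-- to finitely many comparisons of affine forms, by their ranges or by their residues mod 2 or 3,
-- which hold uniformly in q and are checked by evaluation: one recipe for each residue of s − 3 mod 6.

module Submission where

open import Defs
open import Data.Empty using (⊥-elim)
open import Data.Fin using (Fin; toℕ; splitAt; _↑ˡ_; _↑ʳ_)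
open import Data.Fin.Patterns using (0F; 1F; 2F; 3F; 4F; 5F)
open import Data.Fin.Properties using (toℕ-injective; toℕ≤pred[n]; splitAt⁻¹-↑ˡ; splitAt⁻¹-↑ʳ)
open import Data.List using (map; allFin; _++_; [_]; _∷_)
open import Data.List.Membership.Propositional using (_∈_)
open import Data.List.Membership.Propositional.Properties using (∈-map⁻)
open import Data.List.Properties using (map-cong)
open import Data.List.Relation.Unary.All as All using (All; []; _∷_)
import Data.List.Relation.Unary.All.Properties as All
open import Data.List.Relation.Unary.AllPairs using ([]; _∷_)
open import Data.List.Relation.Unary.Unique.Propositional using (Unique)
import Data.List.Relation.Unary.Unique.Propositional.Properties as Unique
open import Data.Nat
open import Data.Nat.DivMod
  using (result; _divMod_; m≡m%n+[m/n]*n; [m+kn]%n≡m%n; m%n%n≡m%n; %-distribˡ-+; %-remove-+ʳ; m<n⇒m%n≡m;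
         /-congʳ; m*n/n≡m)
open import Data.Nat.Divisibility using (_∣_; _∣?_; divides; ∣-antisym; ∣-refl; ∣m⇒∣m*n)
open import Data.Nat.GCD using (gcd; gcd[m,n]∣m; gcd-greatest; gcd[m,n]≢0)
open import Data.Nat.Properties
open import Data.Nat.Tactic.RingSolver using (solve-∀)
open import Data.Product using (Σ; _×_; _,_)
open import Data.Sum using (_⊎_; inj₁; inj₂)
open import Data.Unit using (tt)
open import Data.Vec.Functional using () renaming (_++_ to _++ᵛ_)
open import Function.Definitions using (Injective)
open import Relation.Binary.Definitions using (DecidableEquality)
open import Relation.Binary.PropositionalEquality hiding ([_])
open import Relation.Nullary using (¬_; Dec; yes; no)
open import Relation.Nullary.Decidable using (_×-dec_; _⊎-dec_; ¬?; map′; True; toWitness)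

-- Affine forms and their separation

record Affine : Set where
  constructor affine
  field
    c₀ c-q c-x : ℕ
open Affine

⟦_⟧ : Affine → ℕ → ℕ → ℕ
⟦ affine α κ β ⟧ q x = α + κ * q + β * x

peak : Affine → ℕ → Affine
peak (affine α κ β) r = affine (α + β * r) (κ + 3 * β) 0

base : Affine → Affine
base (affine α κ β) = affine α κ 0

_≤ᶜ_ : Affine → Affine → Set
F ≤ᶜ G = c₀ F ≤ c₀ G × c-q F ≤ c-q G × c-x F ≤ c-x G

_<ᶜ_ : Affine → Affine → Set
F <ᶜ G = c₀ F < c₀ G × c-q F ≤ c-q G × c-x F ≤ c-x G

_≤ᶜ?_ : ∀ F G → Dec (F ≤ᶜ G)
F ≤ᶜ? G = c₀ F ≤? c₀ G ×-dec c-q F ≤? c-q G ×-dec c-x F ≤? c-x G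

_<ᶜ?_ : ∀ F G → Dec (F <ᶜ G)
F <ᶜ? G = c₀ F <? c₀ G ×-dec c-q F ≤? c-q G ×-dec c-x F ≤? c-x G

⟦⟧-mono-≤ : ∀ {F G} q x → F ≤ᶜ G → ⟦ F ⟧ q x ≤ ⟦ G ⟧ q x
⟦⟧-mono-≤ q x (α≤ , κ≤ , β≤) = +-mono-≤ (+-mono-≤ α≤ (*-monoˡ-≤ q κ≤)) (*-monoˡ-≤ x β≤)

⟦⟧-mono-< : ∀ {F G} q x → F <ᶜ G → ⟦ F ⟧ q x < ⟦ G ⟧ q x
⟦⟧-mono-< q x (α< , κ≤ , β≤) = +-mono-<-≤ (+-mono-<-≤ α< (*-monoˡ-≤ q κ≤)) (*-monoˡ-≤ x β≤)

⟦⟧≤⟦peak⟧ : ∀ F r q x → x ≤ r + 3 * q → ⟦ F ⟧ q x ≤ ⟦ peak F r ⟧ q 0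
⟦⟧≤⟦peak⟧ (affine α κ β) r q x x≤ = begin
  α + κ * q + β * x             ≤⟨ +-monoʳ-≤ (α + κ * q) (*-monoʳ-≤ β x≤) ⟩
  α + κ * q + β * (r + 3 * q)   ≡⟨ regroup α κ β r q ⟩
  α + β * r + (κ + 3 * β) * q + 0 * 0 ∎
  where
    open ≤-Reasoning
    regroup : ∀ α κ β r q → α + κ * q + β * (r + 3 * q) ≡ α + β * r + (κ + 3 * β) * q + 0 * 0
    regroup = solve-∀

⟦base⟧≤⟦⟧ : ∀ F q y → ⟦ base F ⟧ q 0 ≤ ⟦ F ⟧ q y
⟦base⟧≤⟦⟧ (affine α κ β) q y = +-monoʳ-≤ (α + κ * q) (z≤n {β * y})

Below : Affine → ℕ → Affine → Set
Below F r G = peak F r <ᶜ base G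

BelowEq : Affine → ℕ → Affine → Set
BelowEq F r G = peak F r ≤ᶜ base G

below? : ∀ F r G → Dec (Below F r G)
below? F r G = peak F r <ᶜ? base G

belowEq? : ∀ F r G → Dec (BelowEq F r G)
belowEq? F r G = peak F r ≤ᶜ? base G

below-sound : ∀ F r G q x y → Below F r G → x ≤ r + 3 * q → ⟦ F ⟧ q x < ⟦ G ⟧ q y
below-sound F r G q x y F<G x≤ = begin-strict
  ⟦ F ⟧ q x          ≤⟨ ⟦⟧≤⟦peak⟧ F r q x x≤ ⟩
  ⟦ peak F r ⟧ q 0   <⟨ ⟦⟧-mono-< q 0 F<G ⟩
  ⟦ base G ⟧ q 0     ≤⟨ ⟦base⟧≤⟦⟧ G q y ⟩
  ⟦ G ⟧ q y          ∎
  where open ≤-Reasoning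

belowEq-sound : ∀ F r G q x y → BelowEq F r G → x ≤ r + 3 * q → ⟦ F ⟧ q x ≤ ⟦ G ⟧ q y
belowEq-sound F r G q x y F≤G x≤ = begin
  ⟦ F ⟧ q x          ≤⟨ ⟦⟧≤⟦peak⟧ F r q x x≤ ⟩
  ⟦ peak F r ⟧ q 0   ≤⟨ ⟦⟧-mono-≤ q 0 F≤G ⟩
  ⟦ base G ⟧ q 0     ≤⟨ ⟦base⟧≤⟦⟧ G q y ⟩
  ⟦ G ⟧ q y          ∎
  where open ≤-Reasoning

%-cancelʳ-+ : ∀ {m} .{{_ : NonZero m}} a b n → (a + n) % m ≡ (b + n) % m → a % m ≡ b % m
%-cancelʳ-+ {m@(suc m′)} a b n eq = begin
  a % m                          ≡⟨ undo a ⟨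
  (a + n + m′ * n) % m           ≡⟨ %-absorb (a + n) ⟩
  ((a + n) % m + m′ * n) % m     ≡⟨ cong (λ z → (z + m′ * n) % m) eq ⟩
  ((b + n) % m + m′ * n) % m     ≡⟨ %-absorb (b + n) ⟨
  (b + n + m′ * n) % m           ≡⟨ undo b ⟩
  b % m                          ∎
  where
    open ≡-Reasoning
    regroup : ∀ c n m′ → c + n + m′ * n ≡ c + n * suc m′
    regroup = solve-∀
    undo : ∀ c → (c + n + m′ * n) % m ≡ c % m
    undo c = trans (cong (_% m) (regroup c n m′)) ([m+kn]%n≡m%n c n m)
    %-absorb : ∀ c → (c + m′ * n) % m ≡ (c % m + m′ * n) % m
    %-absorb c = begin
      (c + m′ * n) % m              ≡⟨ %-distribˡ-+ c (m′ * n) m ⟩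
      (c % m + m′ * n % m) % m      ≡⟨ cong (λ z → (z + m′ * n % m) % m) (m%n%n≡m%n c m) ⟨
      (c % m % m + m′ * n % m) % m  ≡⟨ %-distribˡ-+ (c % m) (m′ * n) m ⟨
      (c % m + m′ * n) % m          ∎

⟦⟧%≡ : ∀ m .{{_ : NonZero m}} F q x → m ∣ c-x F → ⟦ F ⟧ q x % m ≡ (c₀ F + c-q F % m * q) % m
⟦⟧%≡ m (affine α κ β) q x m∣β = begin
  (α + κ * q + β * x) % m                  ≡⟨ %-remove-+ʳ (α + κ * q) (∣m⇒∣m*n x m∣β) ⟩
  (α + κ * q) % m                          ≡⟨ cong (λ z → (α + z * q) % m) (m≡m%n+[m/n]*n κ m) ⟩
  (α + (κ % m + κ / m * m) * q) % m        ≡⟨ cong (_% m) (regroup α (κ % m) (κ / m) m q) ⟩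
  (α + κ % m * q + κ / m * q * m) % m      ≡⟨ [m+kn]%n≡m%n (α + κ % m * q) (κ / m * q) m ⟩
  (α + κ % m * q) % m                      ∎
  where
    open ≡-Reasoning
    regroup : ∀ α r d m q → α + (r + d * m) * q ≡ α + r * q + d * q * m
    regroup = solve-∀

ResidueApart : (m : ℕ) .{{_ : NonZero m}} → Affine → Affine → Set
ResidueApart m F G = m ∣ c-x F × m ∣ c-x G × c-q F % m ≡ c-q G % m × c₀ F % m ≢ c₀ G % m

residueApart? : ∀ m .{{_ : NonZero m}} F G → Dec (ResidueApart m F G)
residueApart? m F G = m ∣? c-x F ×-dec m ∣? c-x G ×-dec c-q F % m ≟ c-q G % m ×-dec ¬? (c₀ F % m ≟ c₀ G % m)

residueApart-sound : ∀ m .{{_ : NonZero m}} F G q x y → ResidueApart m F G → ⟦ F ⟧ q x ≢ ⟦ G ⟧ q y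
residueApart-sound m F G q x y (m∣βF , m∣βG , κF≡κG , αF≢αG) F≡G =
  αF≢αG (%-cancelʳ-+ (c₀ F) (c₀ G) _ (begin
  (c₀ F + c-q F % m * q) % m   ≡⟨ ⟦⟧%≡ m F q x m∣βF ⟨
  ⟦ F ⟧ q x % m                ≡⟨ cong (_% m) F≡G ⟩
  ⟦ G ⟧ q y % m                ≡⟨ ⟦⟧%≡ m G q y m∣βG ⟩
  (c₀ G + c-q G % m * q) % m   ≡⟨ cong (λ z → (c₀ G + z * q) % m) κF≡κG ⟨
  (c₀ G + c-q F % m * q) % m   ∎))
  where open ≡-Reasoning

Apart : Affine → ℕ → Affine → ℕ → Set
Apart F r G r′ = Below F r G ⊎ Below G r′ F ⊎ ResidueApart 2 F G ⊎ ResidueApart 3 F G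

apart? : ∀ F r G r′ → Dec (Apart F r G r′)
apart? F r G r′ = below? F r G ⊎-dec below? G r′ F ⊎-dec residueApart? 2 F G ⊎-dec residueApart? 3 F G

apart-sound : ∀ F r G r′ q x y → Apart F r G r′ → x ≤ r + 3 * q → y ≤ r′ + 3 * q →
              ⟦ F ⟧ q x ≢ ⟦ G ⟧ q y
apart-sound F r G r′ q x y (inj₁ F<G) x≤ y≤ = <⇒≢ (below-sound F r G q x y F<G x≤)
apart-sound F r G r′ q x y (inj₂ (inj₁ G<F)) x≤ y≤ = >⇒≢ (below-sound G r′ F q y x G<F y≤)
apart-sound F r G r′ q x y (inj₂ (inj₂ (inj₁ mod2))) x≤ y≤ = residueApart-sound 2 F G q x y mod2
apart-sound F r G r′ q x y (inj₂ (inj₂ (inj₂ mod3))) x≤ y≤ = residueApart-sound 3 F G q x y mod3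

-- Families indexed by i + e = r + 3q

record Form : Set where
  constructor form
  field
    c₀ c-i c-e : ℕ

eval : Form → ℕ → ℕ → ℕ
eval (form a b c) i e = a + b * i + c * e

_⊕_ : Form → Form → Form
form a b c ⊕ form a′ b′ c′ = form (a + a′) (b + b′) (c + c′)

eval-⊕ : ∀ v w i e → eval (v ⊕ w) i e ≡ eval v i e + eval w i e
eval-⊕ (form a b c) (form a′ b′ c′) = distribute a b c a′ b′ c′
  where
    distribute : ∀ a b c a′ b′ c′ i e →
                 (a + a′) + (b + b′) * i + (c + c′) * e ≡ (a + b * i + c * e) + (a′ + b′ * i + c′ * e)
    distribute = solve-∀

_≟ᶠ_ : DecidableEquality Form
form a b c ≟ᶠ form a′ b′ c′ =
  map′ (λ { (refl , refl , refl) → refl }) (λ { refl → refl , refl , refl })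
       (a ≟ a′ ×-dec b ≟ b′ ×-dec c ≟ c′)

-- On i + e = r + 3q the smaller of the coefficients b, c is absorbed into the constant and the q-slope.
normalise : Form → ℕ → Affine
normalise (form a b c) r with c ≤? b
... | yes _ = affine (a + c * r) (3 * c) (b ∸ c)
... | no _  = affine (a + b * r) (3 * b) (c ∸ b)

pick : Form → ℕ → ℕ → ℕ
pick (form a b c) i e with c ≤? b
... | yes _ = i
... | no _  = e

eval≡⟦normalise⟧ : ∀ v r q i e → i + e ≡ r + 3 * q → eval v i e ≡ ⟦ normalise v r ⟧ q (pick v i e)
eval≡⟦normalise⟧ (form a b c) r q i e i+e≡ with c ≤? b
... | yes c≤b = begin
  a + b * i + c * e                        ≡⟨ cong (λ z → a + z * i + c * e) (m+[n∸m]≡n c≤b) ⟨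
  a + (c + (b ∸ c)) * i + c * e            ≡⟨ regroup a c (b ∸ c) i e ⟩
  a + c * (i + e) + (b ∸ c) * i            ≡⟨ cong (λ z → a + c * z + (b ∸ c) * i) i+e≡ ⟩
  a + c * (r + 3 * q) + (b ∸ c) * i        ≡⟨ expand a c (b ∸ c) r q i ⟩
  a + c * r + 3 * c * q + (b ∸ c) * i      ∎
  where
    open ≡-Reasoning
    regroup : ∀ a c d i e → a + (c + d) * i + c * e ≡ a + c * (i + e) + d * i
    regroup = solve-∀
    expand : ∀ a c d r q i → a + c * (r + 3 * q) + d * i ≡ a + c * r + 3 * c * q + d * i
    expand = solve-∀
... | no c≰b = begin
  a + b * i + c * e                        ≡⟨ cong (λ z → a + b * i + z * e) (m+[n∸m]≡n b≤c) ⟨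
  a + b * i + (b + (c ∸ b)) * e            ≡⟨ regroup a b (c ∸ b) i e ⟩
  a + b * (i + e) + (c ∸ b) * e            ≡⟨ cong (λ z → a + b * z + (c ∸ b) * e) i+e≡ ⟩
  a + b * (r + 3 * q) + (c ∸ b) * e        ≡⟨ expand a b (c ∸ b) r q e ⟩
  a + b * r + 3 * b * q + (c ∸ b) * e      ∎
  where
    open ≡-Reasoning
    b≤c : b ≤ c
    b≤c = <⇒≤ (≰⇒> c≰b)
    regroup : ∀ a b d i e → a + b * i + (b + d) * e ≡ a + b * (i + e) + d * e
    regroup = solve-∀
    expand : ∀ a b d r q e → a + b * (r + 3 * q) + d * e ≡ a + b * r + 3 * b * q + d * e
    expand = solve-∀

pick≤ : ∀ v i e → pick v i e ≤ i + e
pick≤ (form a b c) i e with c ≤? b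
... | yes _ = m≤m+n i e
... | no _  = m≤n+m e i

family : (r q : ℕ) → Form → Fin (suc (r + 3 * q)) → ℕ
family r q v i = eval v (toℕ i) (r + 3 * q ∸ toℕ i)

position : (r q : ℕ) → Form → Fin (suc (r + 3 * q)) → ℕ
position r q v i = pick v (toℕ i) (r + 3 * q ∸ toℕ i)

module _ (r q : ℕ) (v : Form) (i : Fin (suc (r + 3 * q))) where

  toℕ+complement : toℕ i + (r + 3 * q ∸ toℕ i) ≡ r + 3 * q
  toℕ+complement = m+[n∸m]≡n (toℕ≤pred[n] i)

  family≡⟦⟧ : family r q v i ≡ ⟦ normalise v r ⟧ q (position r q v i)
  family≡⟦⟧ = eval≡⟦normalise⟧ v r q _ _ toℕ+complement

  position≤ : position r q v i ≤ r + 3 * q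
  position≤ = subst (position r q v i ≤_) toℕ+complement (pick≤ v _ _)

position-injective : ∀ r q v → Injective _≡_ _≡_ (position r q v)
position-injective r q (form a b c) {i} {j} eq with c ≤? b
... | yes _ = toℕ-injective eq
... | no _  = toℕ-injective (∸-cancelˡ-≡ (toℕ≤pred[n] i) (toℕ≤pred[n] j) eq)

⟦⟧-injective : ∀ F q → 0 < c-x F → Injective _≡_ _≡_ (⟦ F ⟧ q)
⟦⟧-injective (affine α κ (suc β)) q _ eq = *-cancelˡ-≡ _ _ (suc β) (+-cancelˡ-≡ (α + κ * q) _ _ eq)

family-injective : ∀ r q v → 0 < c-x (normalise v r) → Injective _≡_ _≡_ (family r q v)
family-injective r q v β>0 {i} {j} eq = position-injective r q v
  (⟦⟧-injective (normalise v r) q β>0 (trans (sym (family≡⟦⟧ r q v i)) (trans eq (family≡⟦⟧ r q v j))))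

family-apart : ∀ r r′ q v w → Apart (normalise v r) r (normalise w r′) r′ →
               ∀ i j → family r q v i ≢ family r′ q w j
family-apart r r′ q v w apart i j eq =
  apart-sound (normalise v r) r (normalise w r′) r′ q _ _ apart (position≤ r q v i) (position≤ r′ q w j)
    (trans (sym (family≡⟦⟧ r q v i)) (trans eq (family≡⟦⟧ r′ q w j)))

family-avoids : ∀ r q v C → Apart (normalise v r) r C 0 → ∀ i → family r q v i ≢ ⟦ C ⟧ q 0
family-avoids r q v C apart i eq =
  apart-sound (normalise v r) r C 0 q _ 0 apart (position≤ r q v i) z≤n (trans (sym (family≡⟦⟧ r q v i)) eq)

family-below : ∀ r q v C → Below (normalise v r) r C → ∀ i → family r q v i < ⟦ C ⟧ q 0
family-below r q v C below i = subst (_< ⟦ C ⟧ q 0) (sym (family≡⟦⟧ r q v i))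
  (below-sound (normalise v r) r C q _ 0 below (position≤ r q v i))

family-belowEq : ∀ r q v C → BelowEq (normalise v r) r C → ∀ i → family r q v i ≤ ⟦ C ⟧ q 0
family-belowEq r q v C below i = subst (_≤ ⟦ C ⟧ q 0) (sym (family≡⟦⟧ r q v i))
  (belowEq-sound (normalise v r) r C q _ 0 below (position≤ r q v i))

family-aboveEq : ∀ r q v C → BelowEq C 0 (normalise v r) → ∀ i → ⟦ C ⟧ q 0 ≤ family r q v i
family-aboveEq r q v C above i = subst (⟦ C ⟧ q 0 ≤_) (sym (family≡⟦⟧ r q v i))
  (belowEq-sound C 0 (normalise v r) q 0 _ above z≤n)

family-≥c₀ : ∀ r q v i → Form.c₀ v ≤ family r q v i
family-≥c₀ r q (form a b c) i = ≤-trans (m≤m+n a _) (m≤m+n _ _)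

family-⊕ : ∀ r q v w i → family r q (v ⊕ w) i ≡ family r q v i + family r q w i
family-⊕ r q v w i = eval-⊕ v w _ _

module _ {m n : ℕ} where

  ++-injective : {f : Fin m → ℕ} {g : Fin n → ℕ} → Injective _≡_ _≡_ f → Injective _≡_ _≡_ g →
                 (∀ i j → f i ≢ g j) → Injective _≡_ _≡_ (f ++ᵛ g)
  ++-injective {f} {g} f-inj g-inj f≢g {i} {j} eq with splitAt m i in split-i | splitAt m j in split-j
  ... | inj₁ a | inj₁ b =
    trans (sym (splitAt⁻¹-↑ˡ split-i)) (trans (cong (_↑ˡ n) (f-inj eq)) (splitAt⁻¹-↑ˡ split-j))
  ... | inj₁ a | inj₂ b = ⊥-elim (f≢g a b eq)
  ... | inj₂ a | inj₁ b = ⊥-elim (f≢g b a (sym eq))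
  ... | inj₂ a | inj₂ b =
    trans (sym (splitAt⁻¹-↑ʳ split-i)) (trans (cong (m ↑ʳ_) (g-inj eq)) (splitAt⁻¹-↑ʳ split-j))

  ++-avoids : ∀ {f : Fin m → ℕ} {g : Fin n → ℕ} {c} → (∀ i → f i ≢ c) → (∀ j → g j ≢ c) →
              ∀ k → (f ++ᵛ g) k ≢ c
  ++-avoids f≢c g≢c k with splitAt m k
  ... | inj₁ a = f≢c a
  ... | inj₂ b = g≢c b

  ++-apart : ∀ {f f′ : Fin m → ℕ} {g g′ : Fin n → ℕ} →
             (∀ i j → f i ≢ f′ j) → (∀ i j → f i ≢ g′ j) →
             (∀ i j → g i ≢ f′ j) → (∀ i j → g i ≢ g′ j) →
             ∀ k l → (f ++ᵛ g) k ≢ (f′ ++ᵛ g′) l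
  ++-apart ff′ fg′ gf′ gg′ k l with splitAt m k | splitAt m l
  ... | inj₁ a | inj₁ b = ff′ a b
  ... | inj₁ a | inj₂ b = fg′ a b
  ... | inj₂ a | inj₁ b = gf′ a b
  ... | inj₂ a | inj₂ b = gg′ a b

-- Folding modulo 4s

module Fold {h n : ℕ} (n≡h+h : n ≡ h + h) where

  h≤n : h ≤ n
  h≤n = subst (h ≤_) (sym n≡h+h) (m≤m+n h h)

  n∸x≡h∸x+h : ∀ {x} → x ≤ h → n ∸ x ≡ (h ∸ x) + h
  n∸x≡h∸x+h {x} x≤h = trans (cong (_∸ x) n≡h+h) (+-∸-comm h x≤h)

  h≤n∸x : ∀ {x} → x ≤ h → h ≤ n ∸ x
  h≤n∸x {x} x≤h = subst (h ≤_) (sym (n∸x≡h∸x+h x≤h)) (m≤n+m h (h ∸ x))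

  h<n∸x : ∀ {x} → x < h → h < n ∸ x
  h<n∸x {x} x<h = subst (h <_) (sym (n∸x≡h∸x+h (<⇒≤ x<h))) (+-monoˡ-< h (m<n⇒0<n∸m x<h))

  fold-small : ∀ {x} → x ≤ h → x ⊓ (n ∸ x) ≡ x
  fold-small x≤h = m≤n⇒m⊓n≡m (≤-trans x≤h (h≤n∸x x≤h))

  fold-large : ∀ {x w} → h ≤ x → x + w ≡ n → x ⊓ (n ∸ x) ≡ w
  fold-large {x} {w} h≤x x+w≡n = trans (m≥n⇒m⊓n≡n (subst (_≤ x) (sym n∸x≡w) w≤x)) n∸x≡w
    where
      n∸x≡w : n ∸ x ≡ w
      n∸x≡w = trans (cong (_∸ x) (sym x+w≡n)) (m+n∸m≡n x w)
      w≤x : w ≤ x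
      w≤x = +-cancelˡ-≤ x w x (begin
        x + w   ≡⟨ trans x+w≡n n≡h+h ⟩
        h + h   ≤⟨ +-mono-≤ h≤x h≤x ⟩
        x + x   ∎)
        where open ≤-Reasoning

  fold-complement : ∀ {x} → x ≤ n → (n ∸ x) ⊓ (n ∸ (n ∸ x)) ≡ x ⊓ (n ∸ x)
  fold-complement {x} x≤n = trans (cong ((n ∸ x) ⊓_) (m∸[m∸n]≡n x≤n)) (⊓-comm (n ∸ x) x)

  in-range : ∀ {x} → 1 ≤ x → x < h → 1 ≤ x × x ≤ n ∸ 1 × x ≢ h
  in-range {x} 1≤x x<h =
    1≤x , subst (x ≤_) (pred[m∸n]≡m∸[1+n] n 0) (<⇒≤pred (<-≤-trans x<h h≤n)) , <⇒≢ x<h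

record Admissible (s a b x y δ σ : ℕ) : Set where
  field
    a-range : 1 ≤ a × a ≤ 4 * s ∸ 1 × a ≢ 2 * s
    b-range : 1 ≤ b × b ≤ 4 * s ∸ 1 × b ≢ 2 * s
    a<b : a < b
    fold-a : a ⊓ (4 * s ∸ a) ≡ x
    fold-b : b ⊓ (4 * s ∸ b) ≡ y
    fold-difference : (b ∸ a) ⊓ (4 * s ∸ b + a) ≡ δ
    fold-sum : oplus s a b ⊓ (4 * s ∸ oplus s a b) ≡ σ

4*s≡2*s+2*s : ∀ s → 4 * s ≡ 2 * s + 2 * s
4*s≡2*s+2*s = solve-∀

record Seed (k x y u w : ℕ) : Set where
  field
    1≤x : 1 ≤ x
    x+u≡y : x + u ≡ y
    1≤u : 1 ≤ u
    y<2s : y < 2 * suc k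
    fold-x+y : (x + y) ⊓ (4 * suc k ∸ (x + y)) ≡ w

module _ {k x y u w : ℕ} (seed : Seed k x y u w) where
  open Seed seed
  open Fold {2 * suc k} {4 * suc k} (4*s≡2*s+2*s (suc k))
  private
    n = 4 * suc k
    h = 2 * suc k
    u≤y : u ≤ y
    u≤y = subst (u ≤_) x+u≡y (m≤n+m u x)
    x<y : x < y
    x<y = subst (x <_) x+u≡y (subst (_≤ x + u) (+-comm x 1) (+-monoʳ-≤ x 1≤u))
    x<h : x < h
    x<h = <-trans x<y y<2s
    y≤n : y ≤ n
    y≤n = ≤-trans (<⇒≤ y<2s) h≤n

  pair-admissible : Admissible (suc k) x y x y u w
  pair-admissible = record
    { a-range = in-range 1≤x x<h
    ; b-range = in-range (≤-trans 1≤x (<⇒≤ x<y)) y<2s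
    ; a<b = x<y
    ; fold-a = fold-small (<⇒≤ x<h)
    ; fold-b = fold-small (<⇒≤ y<2s)
    ; fold-difference = trans (cong (_⊓ (n ∸ y + x)) y∸x≡u) (m≤n⇒m⊓n≡m u≤n∸y+x)
    ; fold-sum = trans (cong (λ z → z ⊓ (n ∸ z)) (m<n⇒m%n≡m x+y<n)) fold-x+y
    }
    where
      y∸x≡u : y ∸ x ≡ u
      y∸x≡u = trans (cong (_∸ x) (sym x+u≡y)) (m+n∸m≡n x u)
      u≤n∸y+x : u ≤ n ∸ y + x
      u≤n∸y+x = ≤-trans (≤-trans u≤y (<⇒≤ (<-trans y<2s (h<n∸x y<2s)))) (m≤m+n (n ∸ y) x)
      x+y<n : x + y < n
      x+y<n = subst (x + y <_) (sym (4*s≡2*s+2*s (suc k))) (+-mono-< x<h y<2s)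

  negated-pair-admissible : Admissible (suc k) x (4 * suc k ∸ y) x y w u
  negated-pair-admissible = record
    { a-range = in-range 1≤x x<h
    ; b-range = m<n⇒0<n∸m (<-≤-trans y<2s h≤n) , ∸-monoʳ-≤ n 1≤y , (λ eq → <⇒≢ (h<n∸x y<2s) (sym eq))
    ; a<b = <-trans x<h (h<n∸x y<2s)
    ; fold-a = fold-small (<⇒≤ x<h)
    ; fold-b = trans (fold-complement y≤n) (fold-small (<⇒≤ y<2s))
    ; fold-difference = begin
        (n ∸ y ∸ x) ⊓ (n ∸ (n ∸ y) + x)  ≡⟨ cong₂ _⊓_ (∸-+-assoc n y x) (cong (_+ x) (m∸[m∸n]≡n y≤n)) ⟩
        (n ∸ (y + x)) ⊓ (y + x)          ≡⟨ ⊓-comm (n ∸ (y + x)) (y + x) ⟩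
        (y + x) ⊓ (n ∸ (y + x))          ≡⟨ cong (λ z → z ⊓ (n ∸ z)) (+-comm y x) ⟩
        (x + y) ⊓ (n ∸ (x + y))          ≡⟨ fold-x+y ⟩
        w                                ∎
    ; fold-sum = begin
        oplus (suc k) x (n ∸ y) ⊓ (n ∸ oplus (suc k) x (n ∸ y))  ≡⟨ cong (λ z → z ⊓ (n ∸ z)) oplus≡n∸u ⟩
        (n ∸ u) ⊓ (n ∸ (n ∸ u))                                  ≡⟨ fold-complement u≤n ⟩
        u ⊓ (n ∸ u)                                              ≡⟨ fold-small (≤-trans u≤y (<⇒≤ y<2s)) ⟩
        u                                                        ∎
    }
    where
      open ≡-Reasoning
      1≤y : 1 ≤ y
      1≤y = ≤-trans 1≤x (<⇒≤ x<y)
      u≤n : u ≤ n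
      u≤n = ≤-trans u≤y y≤n
      x≤n∸u : x ≤ n ∸ u
      x≤n∸u = subst (_≤ n ∸ u) (m+n∸n≡m x u) (∸-monoˡ-≤ u (subst (_≤ n) (sym x+u≡y) y≤n))
      x+[n∸y]≡n∸u : x + (n ∸ y) ≡ n ∸ u
      x+[n∸y]≡n∸u = begin
        x + (n ∸ y)        ≡⟨ cong (λ z → x + (n ∸ z)) (trans (sym x+u≡y) (+-comm x u)) ⟩
        x + (n ∸ (u + x))  ≡⟨ cong (x +_) (∸-+-assoc n u x) ⟨
        x + (n ∸ u ∸ x)    ≡⟨ m+[n∸m]≡n x≤n∸u ⟩
        n ∸ u              ∎
      oplus≡n∸u : oplus (suc k) x (n ∸ y) ≡ n ∸ u
      oplus≡n∸u = trans (cong (_% n) x+[n∸y]≡n∸u) (m<n⇒m%n≡m (∸-monoʳ-< 1≤u u≤n))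

Solution : ℕ → Set
Solution s = Σ ℕ λ t → Σ (Fin (s ∸ 1) → ℕ) λ a → Σ (Fin (s ∸ 1) → ℕ) λ b →
  let d = (2 * t) ⊓ (4 * s ∸ 2 * t) in
  (1 ≤ t × t ≤ 2 * s ∸ 1 × t ≢ s)
  × (∀ j → 1 ≤ a j × a j ≤ 4 * s ∸ 1 × a j ≢ 2 * s)
  × (∀ j → 1 ≤ b j × b j ≤ 4 * s ∸ 1 × b j ≢ 2 * s)
  × (∀ j → a j < b j)
  × Unique (map (λ j → a j ⊓ (4 * s ∸ a j)) (allFin (s ∸ 1))
            ++ map (λ j → b j ⊓ (4 * s ∸ b j)) (allFin (s ∸ 1))
            ++ [ t ])
  × Unique (map (λ j → (b j ∸ a j) ⊓ (4 * s ∸ b j + a j)) (allFin (s ∸ 1))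
            ++ (2 * s) ∷ [ d ])
  × Unique (map (λ j → oplus s (a j) (b j) ⊓ (4 * s ∸ oplus s (a j) (b j))) (allFin (s ∸ 1))
            ++ [ 2 * s ])
  × 2 ∣ ratio4s s d

2∣ratio4s[s,2] : ∀ k → 2 ∣ ratio4s (suc k) 2
2∣ratio4s[s,2] k = subst (2 ∣_) (sym ratio≡2s) (divides (suc k) (*-comm 2 (suc k)))
  where
    double : ∀ s → 4 * s ≡ 2 * s * 2
    double = solve-∀
    4s≡2s*2 : 4 * suc k ≡ 2 * suc k * 2
    4s≡2s*2 = double (suc k)
    gcd≡2 : gcd 2 (4 * suc k) ≡ 2
    gcd≡2 = ∣-antisym (gcd[m,n]∣m 2 (4 * suc k)) (gcd-greatest ∣-refl (divides (2 * suc k) 4s≡2s*2))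
    ratio≡2s : ratio4s (suc k) 2 ≡ 2 * suc k
    ratio≡2s = trans (/-congʳ {{≢-nonZero (gcd[m,n]≢0 2 (4 * suc k) (inj₂ λ ()))}} gcd≡2)
                     (trans (cong (_/ 2) 4s≡2s*2) (m*n/n≡m (2 * suc k) 2))

unique-map-allFin-++ : ∀ {n} {f : Fin n → ℕ} {ys} → Injective _≡_ _≡_ f → Unique ys →
                       (∀ i → All (f i ≢_) ys) → Unique (map f (allFin n) ++ ys)
unique-map-allFin-++ {n} {f} {ys} f-inj ys-unique f∉ys =
  Unique.++⁺ (Unique.map⁺ f-inj (Unique.allFin⁺ n)) ys-unique disjoint
  where
    disjoint : ∀ {v} → ¬ (v ∈ map f (allFin n) × v ∈ ys)
    disjoint (v∈fs , v∈ys) with ∈-map⁻ f v∈fs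
    ... | i , _ , refl = All.lookup (f∉ys i) v∈ys refl

all-map-allFin : ∀ {n} {P : ℕ → Set} (g : Fin n → ℕ) → (∀ j → P (g j)) → All P (map g (allFin n))
all-map-allFin g Pg = All.map⁺ (All.tabulate⁺ Pg)

d≡2 : ∀ k → (2 * 1) ⊓ (4 * suc k ∸ 2 * 1) ≡ 2
d≡2 k = m≤n⇒m⊓n≡m (∸-monoˡ-≤ 2 (*-monoʳ-≤ 4 (s≤s (z≤n {k}))))

module _ (k : ℕ) (a b x y δ σ : Fin (suc k) → ℕ)
         (admissible : ∀ j → Admissible (suc (suc k)) (a j) (b j) (x j) (y j) (δ j) (σ j)) where
  private
    s = suc (suc k)
    module A j = Admissible (admissible j)

  solution : Injective _≡_ _≡_ x → Injective _≡_ _≡_ y → (∀ i j → x i ≢ y j) →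
             (∀ i → x i ≢ 1) → (∀ i → y i ≢ 1) →
             Injective _≡_ _≡_ δ → (∀ i → δ i ≢ 2 * s) → (∀ i → δ i ≢ 2) →
             Injective _≡_ _≡_ σ → (∀ i → σ i ≢ 2 * s) → Solution s
  solution x-inj y-inj x≢y x≢1 y≢1 δ-inj δ≢2s δ≢2 σ-inj σ≢2s =
    1 , a , b , (s≤s z≤n , 1≤2s∸1 , λ ()) ,
    A.a-range , A.b-range , A.a<b ,
    subst₂ (λ xs ys → Unique (xs ++ ys ++ [ 1 ])) (folded A.fold-a) (folded A.fold-b)
      (unique-map-allFin-++ x-inj (unique-map-allFin-++ y-inj ([] ∷ []) (λ i → y≢1 i ∷ []))
        (λ i → All.++⁺ (all-map-allFin y (x≢y i)) (x≢1 i ∷ []))) ,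
    subst₂ (λ ds d → Unique (ds ++ 2 * s ∷ [ d ])) (folded A.fold-difference) (sym (d≡2 (suc k)))
      (unique-map-allFin-++ δ-inj ((2s≢2 ∷ []) ∷ [] ∷ []) (λ i → δ≢2s i ∷ δ≢2 i ∷ [])) ,
    subst (λ ss → Unique (ss ++ [ 2 * s ])) (folded A.fold-sum)
      (unique-map-allFin-++ σ-inj ([] ∷ []) (λ i → σ≢2s i ∷ [])) ,
    subst (λ d → 2 ∣ ratio4s s d) (sym (d≡2 (suc k))) (2∣ratio4s[s,2] (suc k))
    where
      folded : ∀ {f g : Fin (suc k) → ℕ} → (∀ j → f j ≡ g j) → map g (allFin (suc k)) ≡ map f (allFin (suc k))
      folded f≗g = sym (map-cong f≗g (allFin (suc k)))
      1≤2s∸1 : 1 ≤ 2 * s ∸ 1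
      1≤2s∸1 = ∸-monoˡ-≤ 1 (*-monoʳ-≤ 2 (s≤s (z≤n {suc k})))
      2s≢2 : 2 * s ≢ 2
      2s≢2 eq = <⇒≢ (*-monoʳ-< 2 (s≤s (s≤s (z≤n {k})))) (sym eq)

solution-2 : Solution 2
solution-2 = solution 0 (λ _ → 2) (λ _ → 3) (λ _ → 2) (λ _ → 3) (λ _ → 1) (λ _ → 3)
  (λ _ → pair-admissible (record
    { 1≤x = s≤s z≤n ; x+u≡y = refl ; 1≤u = s≤s z≤n ; y<2s = s≤s (s≤s (s≤s (s≤s z≤n))) ; fold-x+y = refl }))
  singleton-injective singleton-injective (λ _ _ ()) (λ _ ()) (λ _ ())
  singleton-injective (λ _ ()) (λ _ ()) singleton-injective (λ _ ())
  where
    singleton-injective : ∀ {f : Fin 1 → ℕ} → Injective _≡_ _≡_ f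
    singleton-injective {x = 0F} {0F} _ = refl

record Half : Set where
  constructor half
  field
    range : ℕ
    x u w : Form

  y : Form
  y = x ⊕ u

DoubleOn : ℕ → ℕ → Form → Set
DoubleOn c r (form a b e) = a + 8 * r ≡ 2 * c × b ≡ 8 × e ≡ 8

family-double : ∀ c r q v → DoubleOn c r v → ∀ i → family r q v i ≡ 2 * ⟦ affine c 12 0 ⟧ q 0
family-double c r q (form a .8 .8) (a+8r≡2c , refl , refl) i = begin
  a + 8 * i′ + 8 * (r + 3 * q ∸ i′)   ≡⟨ regroup a i′ (r + 3 * q ∸ i′) ⟩
  a + 8 * (i′ + (r + 3 * q ∸ i′))     ≡⟨ cong (λ z → a + 8 * z) (toℕ+complement r q (form a 8 8) i) ⟩
  a + 8 * (r + 3 * q)                 ≡⟨ regroup′ a r q ⟩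
  a + 8 * r + 24 * q                  ≡⟨ cong (_+ 24 * q) a+8r≡2c ⟩
  2 * c + 24 * q                      ≡⟨ regroup″ c q ⟩
  2 * (c + 12 * q + 0 * 0)            ∎
  where
    open ≡-Reasoning
    i′ = toℕ i
    regroup : ∀ a i e → a + 8 * i + 8 * e ≡ a + 8 * (i + e)
    regroup = solve-∀
    regroup′ : ∀ a r q → a + 8 * (r + 3 * q) ≡ a + 8 * r + 24 * q
    regroup′ = solve-∀
    regroup″ : ∀ c q → 2 * c + 24 * q ≡ 2 * (c + 12 * q + 0 * 0)
    regroup″ = solve-∀

doubleOn? : ∀ c r v → Dec (DoubleOn c r v)
doubleOn? c r (form a b e) = a + 8 * r ≟ 2 * c ×-dec b ≟ 8 ×-dec e ≟ 8

module _ (C : Affine) (h : Half) where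
  open Half h

  -- Either 2s ≤ x + y and x + y + w = 4s, or x + y ≤ 2s and x + y = w: in both cases w = |x + y|.
  FoldsSum : Set
  FoldsSum = (BelowEq C 0 (normalise (x ⊕ y) range) × DoubleOn (c₀ C) range ((x ⊕ y) ⊕ w))
           ⊎ (BelowEq (normalise (x ⊕ y) range) range C × x ⊕ y ≡ w)

  ValidHalf : Set
  ValidHalf = 1 ≤ Form.c₀ x × 1 ≤ Form.c₀ u × Below (normalise y range) range C × FoldsSum

validHalf? : ∀ C h → Dec (ValidHalf C h)
validHalf? C h = 1 ≤? Form.c₀ x ×-dec 1 ≤? Form.c₀ u ×-dec below? (normalise y range) range C ×-dec
  (   (belowEq? C 0 (normalise (x ⊕ y) range) ×-dec doubleOn? (c₀ C) range ((x ⊕ y) ⊕ w))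
  ⊎-dec (belowEq? (normalise (x ⊕ y) range) range C ×-dec (x ⊕ y) ≟ᶠ w))
  where open Half h

half-seeds : ∀ {k} c q → 2 * suc k ≡ ⟦ affine c 12 0 ⟧ q 0 → ∀ h → ValidHalf (affine c 12 0) h →
             let open Half h; member = λ v → family range q v in
             ∀ i → Seed k (member x i) (member y i) (member u i) (member w i)
half-seeds {k} c q 2s≡ h (1≤c₀x , 1≤c₀u , y<C , folds) i = record
  { 1≤x = ≤-trans 1≤c₀x (family-≥c₀ range q x i)
  ; x+u≡y = sym (family-⊕ range q x u i)
  ; 1≤u = ≤-trans 1≤c₀u (family-≥c₀ range q u i)
  ; y<2s = subst (Y <_) (sym 2s≡) (family-below range q y C y<C i)
  ; fold-x+y = fold-X+Y folds
  }
  where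
    open Half h
    open Fold {2 * suc k} {4 * suc k} (4*s≡2*s+2*s (suc k))
    C = affine c 12 0
    X = family range q x i
    Y = family range q y i
    W = family range q w i
    X+Y≡ : family range q (x ⊕ y) i ≡ X + Y
    X+Y≡ = family-⊕ range q x y i

    fold-X+Y : FoldsSum C h → (X + Y) ⊓ (4 * suc k ∸ (X + Y)) ≡ W
    fold-X+Y (inj₁ (2s≤x+y , double)) = fold-large 2s≤X+Y (begin
      X + Y + W                          ≡⟨ cong (_+ W) X+Y≡ ⟨
      family range q (x ⊕ y) i + W       ≡⟨ family-⊕ range q (x ⊕ y) w i ⟨
      family range q ((x ⊕ y) ⊕ w) i     ≡⟨ family-double c range q ((x ⊕ y) ⊕ w) double i ⟩
      2 * ⟦ C ⟧ q 0                      ≡⟨ cong (2 *_) 2s≡ ⟨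
      2 * (2 * suc k)                    ≡⟨ *-assoc 2 2 (suc k) ⟨
      4 * suc k                          ∎)
      where
        open ≡-Reasoning
        2s≤X+Y : 2 * suc k ≤ X + Y
        2s≤X+Y = subst₂ _≤_ (sym 2s≡) X+Y≡ (family-aboveEq range q (x ⊕ y) C 2s≤x+y i)
    fold-X+Y (inj₂ (x+y≤2s , refl)) = trans (fold-small X+Y≤2s) (sym X+Y≡)
      where
        X+Y≤2s : X + Y ≤ 2 * suc k
        X+Y≤2s = subst₂ _≤_ X+Y≡ (sym 2s≡) (family-belowEq range q (x ⊕ y) C x+y≤2s i)

constant : ℕ → Affine
constant n = affine n 0 0

module Joint (rA rB : ℕ) where

  InjectiveOn : Form × Form → Set
  InjectiveOn (f , g) = 0 < c-x (normalise f rA) × 0 < c-x (normalise g rB)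
                      × Apart (normalise f rA) rA (normalise g rB) rB

  AvoidsOn : Form × Form → Affine → Set
  AvoidsOn (f , g) C = Apart (normalise f rA) rA C 0 × Apart (normalise g rB) rB C 0

  ApartOn : Form × Form → Form × Form → Set
  ApartOn (f , g) (f′ , g′) =
    Apart (normalise f rA) rA (normalise f′ rA) rA × Apart (normalise f rA) rA (normalise g′ rB) rB
    × Apart (normalise g rB) rB (normalise f′ rA) rA × Apart (normalise g rB) rB (normalise g′ rB) rB

  module _ (q : ℕ) where
    joined : Form × Form → Fin (suc (rA + 3 * q) + suc (rB + 3 * q)) → ℕ
    joined (f , g) = family rA q f ++ᵛ family rB q g

    injectiveOn-sound : ∀ fg → InjectiveOn fg → Injective _≡_ _≡_ (joined fg)
    injectiveOn-sound (f , g) (f-inj , g-inj , f≢g) =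
      ++-injective (family-injective rA q f f-inj) (family-injective rB q g g-inj) (family-apart rA rB q f g f≢g)

    avoidsOn-sound : ∀ fg C → AvoidsOn fg C → ∀ k → joined fg k ≢ ⟦ C ⟧ q 0
    avoidsOn-sound (f , g) C (f≢C , g≢C) = ++-avoids (family-avoids rA q f C f≢C) (family-avoids rB q g C g≢C)

    apartOn-sound : ∀ fg fg′ → ApartOn fg fg′ → ∀ k l → joined fg k ≢ joined fg′ l
    apartOn-sound (f , g) (f′ , g′) (ff′ , fg′ , gf′ , gg′) =
      ++-apart (family-apart rA rA q f f′ ff′) (family-apart rA rB q f g′ fg′)
               (family-apart rB rA q g f′ gf′) (family-apart rB rB q g g′ gg′)

  injectiveOn? : ∀ fg → Dec (InjectiveOn fg)
  injectiveOn? (f , g) = 0 <? c-x (normalise f rA) ×-dec 0 <? c-x (normalise g rB)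
                         ×-dec apart? (normalise f rA) rA (normalise g rB) rB

  avoidsOn? : ∀ fg C → Dec (AvoidsOn fg C)
  avoidsOn? (f , g) C = apart? (normalise f rA) rA C 0 ×-dec apart? (normalise g rB) rB C 0

  apartOn? : ∀ fg fg′ → Dec (ApartOn fg fg′)
  apartOn? (f , g) (f′ , g′) =
    apart? (normalise f rA) rA (normalise f′ rA) rA ×-dec apart? (normalise f rA) rA (normalise g′ rB) rB
    ×-dec apart? (normalise g rB) rB (normalise f′ rA) rA ×-dec apart? (normalise g rB) rB (normalise g′ rB) rB

record Recipe : Set where
  constructor recipe
  field
    first second : Half

  open Half
  rA = range first
  rB = range second

  -- 2s as a form in q, for s = 3 + rA + rB + 6q
  twice-s : Affine
  twice-s = affine (2 * (3 + rA + rB)) 12 0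

  -- the second half realises the pairs (x, 4s − y), which interchanges differences and sums
  xs ys δs σs : Form × Form
  xs = x first , x second
  ys = y first , y second
  δs = u first , w second
  σs = w first , u second

  open Joint rA rB

  Valid : Set
  Valid = ValidHalf twice-s first × ValidHalf twice-s second
        × InjectiveOn xs × InjectiveOn ys × ApartOn xs ys
        × AvoidsOn xs (constant 1) × AvoidsOn ys (constant 1)
        × InjectiveOn δs × AvoidsOn δs twice-s × AvoidsOn δs (constant 2)
        × InjectiveOn σs × AvoidsOn σs twice-s

valid? : ∀ R → Dec (Recipe.Valid R)
valid? R = validHalf? twice-s first ×-dec validHalf? twice-s second
  ×-dec injectiveOn? xs ×-dec injectiveOn? ys ×-dec apartOn? xs ys
  ×-dec avoidsOn? xs (constant 1) ×-dec avoidsOn? ys (constant 1)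
  ×-dec injectiveOn? δs ×-dec avoidsOn? δs twice-s ×-dec avoidsOn? δs (constant 2)
  ×-dec injectiveOn? σs ×-dec avoidsOn? σs twice-s
  where
    open Recipe R
    open Joint rA rB

recipe-solution : ∀ R → Recipe.Valid R → ∀ q →
                  let open Recipe R in Solution (suc (suc (rA + 3 * q + suc (rB + 3 * q))))
recipe-solution R (first-valid , second-valid , x-inj , y-inj , x≢y , x≢1 , y≢1 ,
                   δ-inj , δ≢2s , δ≢2 , σ-inj , σ≢2s) q =
  solution k (joined q xs) b (joined q xs) (joined q ys) (joined q δs) (joined q σs) admissible
    (injectiveOn-sound q xs x-inj) (injectiveOn-sound q ys y-inj) (apartOn-sound q xs ys x≢y)
    (avoidsOn-sound q xs (constant 1) x≢1) (avoidsOn-sound q ys (constant 1) y≢1)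
    (injectiveOn-sound q δs δ-inj) (avoids-2s δs δ≢2s) (avoidsOn-sound q δs (constant 2) δ≢2)
    (injectiveOn-sound q σs σ-inj) (avoids-2s σs σ≢2s)
  where
    open Recipe R
    open Joint rA rB
    k = rA + 3 * q + suc (rB + 3 * q)
    s = suc (suc k)

    2s≡ : 2 * s ≡ ⟦ twice-s ⟧ q 0
    2s≡ = expand rA rB q
      where
        expand : ∀ rA rB q → 2 * suc (suc (rA + 3 * q + suc (rB + 3 * q))) ≡ 2 * (3 + rA + rB) + 12 * q + 0 * 0
        expand = solve-∀

    b : Fin (suc k) → ℕ
    b = family rA q (Half.y first) ++ᵛ λ i → 4 * s ∸ family rB q (Half.y second) i

    admissible : ∀ j → Admissible s (joined q xs j) (b j) (joined q xs j) (joined q ys j) (joined q δs j) (joined q σs j)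
    admissible j with splitAt (suc (rA + 3 * q)) j
    ... | inj₁ i = pair-admissible (half-seeds (2 * (3 + rA + rB)) q 2s≡ first first-valid i)
    ... | inj₂ i = negated-pair-admissible (half-seeds (2 * (3 + rA + rB)) q 2s≡ second second-valid i)

    avoids-2s : ∀ fg → AvoidsOn fg twice-s → ∀ j → joined q fg j ≢ 2 * s
    avoids-2s fg avoids j eq = avoidsOn-sound q fg twice-s avoids j (trans eq 2s≡)

recipe-for : Fin 6 → Recipe
recipe-for 0F = recipe (half 0 (form 4 3 1) (form 1 0 3) (form 3 2 3)) (half 0 (form 2 1 0) (form 1 2 1) (form 5 4 1))
recipe-for 1F = recipe (half 1 (form 2 3 1) (form 1 0 3) (form 3 2 3)) (half 0 (form 2 1 0) (form 2 2 1) (form 6 4 1))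
recipe-for 2F = recipe (half 1 (form 4 3 1) (form 1 0 3) (form 3 2 3)) (half 1 (form 2 1 0) (form 1 2 1) (form 5 4 1))
recipe-for 3F = recipe (half 2 (form 2 1 0) (form 1 0 3) (form 5 2 3)) (half 1 (form 5 3 1) (form 2 1 2) (form 4 1 4))
recipe-for 4F = recipe (half 2 (form 4 3 1) (form 1 1 2) (form 3 1 4)) (half 2 (form 2 1 0) (form 1 0 3) (form 5 2 3))
recipe-for 5F = recipe (half 3 (form 2 3 1) (form 1 0 3) (form 3 2 3)) (half 2 (form 2 1 0) (form 2 2 1) (form 6 4 1))

recipe-for-valid : ∀ ρ → Recipe.Valid (recipe-for ρ)
recipe-for-valid ρ = toWitness (checked ρ)
  where
    checked : ∀ ρ → True (valid? (recipe-for ρ))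
    checked 0F = tt
    checked 1F = tt
    checked 2F = tt
    checked 3F = tt
    checked 4F = tt
    checked 5F = tt

recipe-for-ranges : ∀ ρ → let open Recipe (recipe-for ρ) in rA + rB ≡ toℕ ρ
recipe-for-ranges 0F = refl
recipe-for-ranges 1F = refl
recipe-for-ranges 2F = refl
recipe-for-ranges 3F = refl
recipe-for-ranges 4F = refl
recipe-for-ranges 5F = refl

lemma2p15 : (s : ℕ) → 2 ≤ s →
    Σ ℕ λ t → Σ (Fin (s ∸ 1) → ℕ) λ a → Σ (Fin (s ∸ 1) → ℕ) λ b →
      let d = (2 * t) ⊓ (4 * s ∸ 2 * t) in
      (1 ≤ t × t ≤ 2 * s ∸ 1 × t ≢ s)
      × (∀ j → 1 ≤ a j × a j ≤ 4 * s ∸ 1 × a j ≢ 2 * s)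
      × (∀ j → 1 ≤ b j × b j ≤ 4 * s ∸ 1 × b j ≢ 2 * s)
      × (∀ j → a j < b j)
      × Unique (map (λ j → a j ⊓ (4 * s ∸ a j)) (allFin (s ∸ 1))
                ++ map (λ j → b j ⊓ (4 * s ∸ b j)) (allFin (s ∸ 1))
                ++ [ t ])
      × Unique (map (λ j → (b j ∸ a j) ⊓ (4 * s ∸ b j + a j)) (allFin (s ∸ 1))
                ++ (2 * s) ∷ [ d ])
      × Unique (map (λ j → oplus s (a j) (b j) ⊓ (4 * s ∸ oplus s (a j) (b j))) (allFin (s ∸ 1))
                ++ [ 2 * s ])
      × 2 ∣ ratio4s s d
lemma2p15 1 (s≤s ())
lemma2p15 2 _ = solution-2
lemma2p15 (suc (suc (suc n))) _ with n divMod 6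
... | result q ρ n≡ρ+q*6 = subst Solution size≡ (recipe-solution (recipe-for ρ) (recipe-for-valid ρ) q)
  where
    open Recipe (recipe-for ρ)
    regroup : ∀ rA rB q → suc (suc (rA + 3 * q + suc (rB + 3 * q))) ≡ 3 + (rA + rB + q * 6)
    regroup = solve-∀
    size≡ : suc (suc (rA + 3 * q + suc (rB + 3 * q))) ≡ 3 + n
    size≡ = begin
      suc (suc (rA + 3 * q + suc (rB + 3 * q)))  ≡⟨ regroup rA rB q ⟩
      3 + (rA + rB + q * 6)                      ≡⟨ cong (λ z → 3 + (z + q * 6)) (recipe-for-ranges ρ) ⟩
      3 + (toℕ ρ + q * 6)                        ≡⟨ cong (3 +_) n≡ρ+q*6 ⟨
      3 + n                                      ∎
      where open ≡-Reasoning
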